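{- Let $q$ be an indeterminate, $k\ge 0$, and $\lambda/\mu$ a horizontal strip with $\lambda\vdash n$. (a) If $k>|\lambda/\mu|$, then $\mathcal{E}_{\lambda/\mu}(k)$ is identically zero. (b) If $k\le|\lambda/\mu|$, then $\mathcal{E}_{\lambda/\mu}(k)$ is a monic polynomial in $q$ of degree $k(n-k)+w_k(\lambda/\mu)$, where $w_k(\lambda/\mu)$ is the sum of the contents of the rightmost $k$ cells of $\lambda/\mu$.
   Context: $[a]_q=(1-q^a)/(1-q)$. Young diagrams in English notation; cell $(r,s)$ (row $r$, column $s$) has content $s-r$. $\lambda/\mu$ (with $\mu\subseteq\lambda$) is the set of cells of $\lambda$ not in $\mu$, $|\lambda/\mu|$ its number of cells; it is a horizontal strip if no two of its cells share a column. For $\lambda\vdash n$, $\mu\vdash j$, fill the cells of $\lambda/\mu$ with $j+1,\dots,n$, rows top to bottom, each row left to right; let $c_\ell$ be the content of the cell containing $\ell$, and $$\mathcal{E}_{\lambda/\mu}(k)=q^{nk-\binom k2}\sum_{j<\ell_1<\cdots<\ell_k\le n}\prod_{m=1}^kq^{ -\ell_m}[\ell_m+1-m+c_{\ell_m}]_q .$$ -}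

module Defs where

open import Data.Nat as ℕ using (ℕ; zero; suc; _∸_; _≤_; _<_)
open import Data.Nat.Combinatorics using (_C_)
open import Data.Integer as ℤ using (ℤ; +_; -[1+_]; 0ℤ; 1ℤ; -1ℤ)
open import Data.Product using (_×_; _,_)
open import Data.List using (List; []; _∷_; map; _++_; concatMap; upTo; length; zip; foldr; filter)
open import Data.List.Relation.Unary.All using (All)
open import Data.List.Relation.Unary.Linked using (Linked)
open import Relation.Nullary.Decidable using (does)
open import Data.Bool using (true; false)
open import Data.Nat.ListAction using (sum)

-- Laurent polynomials in q with integer coefficients, represented as
-- formal finite sums of monomials (exponent , coefficient).
-- Only the coefficient extraction `coeff` is meaningful (two lists
-- denote the same Laurent polynomial iff all coefficients agree).

LPoly : Set
LPoly = List (ℤ × ℤ)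

mono : ℤ → ℤ → LPoly
mono e c = (e , c) ∷ []

one : LPoly
one = mono 0ℤ 1ℤ

_⊕_ : LPoly → LPoly → LPoly
p ⊕ r = p ++ r

_⊗_ : LPoly → LPoly → LPoly
p ⊗ r = concatMap (λ { (e , c) → map (λ { (e' , c') → (e ℤ.+ e' , c ℤ.* c') }) r }) p

coeff : ℤ → LPoly → ℤ
coeff e [] = 0ℤ
coeff e ((e' , c) ∷ p) with does (e ℤ.≟ e')
... | true  = c ℤ.+ coeff e p
... | false = coeff e p

-- q-integer [a]_q = (1 - q^a)/(1 - q) for an integer a:
--   a = n ≥ 0 :  1 + q + ... + q^(n-1)
--   a = -(n+1) : -(q^(-1) + q^(-2) + ... + q^(-(n+1)))
qint : ℤ → LPoly
qint (+ n)     = map (λ i → (+ i , 1ℤ)) (upTo n)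
qint -[1+ n ]  = map (λ i → (-[1+ i ] , -1ℤ)) (upTo (suc n))

IsPartition : List ℕ → Set
IsPartition lam = All (0 <_) lam × Linked (λ a b → b ≤ a) lam

-- i-th part (0-indexed), 0 beyond the length
part : List ℕ → ℕ → ℕ
part []       i       = 0
part (x ∷ xs) zero    = x
part (x ∷ xs) (suc i) = part xs i

-- μ ⊆ λ and λ/μ is a horizontal strip (no two cells in one column),
-- i.e. μ_i ≤ λ_i and λ_{i+1} ≤ μ_i for all i.
_⊆ₚ_ : List ℕ → List ℕ → Set
mu ⊆ₚ lam = ∀ i → part mu i ≤ part lam i

HorizontalStrip : List ℕ → List ℕ → Set
HorizontalStrip lam mu = (mu ⊆ₚ lam) × (∀ i → part lam (suc i) ≤ part mu i)

-- Cells (row , column), 1-indexed, of λ/μ in reading order: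
-- rows top to bottom, each row left to right.

head0 : List ℕ → ℕ
head0 []      = 0
head0 (x ∷ _) = x

tail0 : List ℕ → List ℕ
tail0 []       = []
tail0 (_ ∷ xs) = xs

cellsFrom : ℕ → List ℕ → List ℕ → List (ℕ × ℕ)
cellsFrom r []          mu = []
cellsFrom r (l ∷ lam)   mu =
  map (λ i → (r , suc (head0 mu ℕ.+ i))) (upTo (l ∸ head0 mu))
  ++ cellsFrom (suc r) lam (tail0 mu)

skewCells : List ℕ → List ℕ → List (ℕ × ℕ)
skewCells lam mu = cellsFrom 1 lam mu

skewSize : List ℕ → List ℕ → ℕ
skewSize lam mu = length (skewCells lam mu)

content : ℕ × ℕ → ℤ
content (r , s) = + s ℤ.- + r

-- cells labelled j+1, j+2, ... (j = |μ|) together with their contents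
labelled : List ℕ → List ℕ → List (ℕ × ℤ)
labelled lam mu =
  zip (map (λ i → suc (sum mu ℕ.+ i)) (upTo (skewSize lam mu)))
      (map content (skewCells lam mu))

-- order-preserving k-element sublists (i.e. increasing label sequences)
choose : {A : Set} → ℕ → List A → List (List A)
choose zero    xs       = [] ∷ []
choose (suc k) []       = []
choose (suc k) (x ∷ xs) = map (x ∷_) (choose k xs) ++ choose (suc k) xs

termProd : ℕ → List (ℕ × ℤ) → LPoly
termProd m []              = one
termProd m ((ℓ , c) ∷ xs)  =
  (mono (ℤ.- (+ ℓ)) 1ℤ ⊗ qint (+ ℓ ℤ.+ 1ℤ ℤ.- + m ℤ.+ c)) ⊗ termProd (suc m) xs

𝓔 : List ℕ → List ℕ → ℕ → LPoly
𝓔 lam mu k =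
  mono (+ (sum lam ℕ.* k) ℤ.- + (k C 2)) 1ℤ
  ⊗ foldr _⊕_ [] (map (termProd 1) (choose k (labelled lam mu)))

-- w_k(λ/μ): sum of contents of the rightmost k cells, i.e. of those cells
-- having fewer than k cells of λ/μ strictly to their right (columns of a
-- horizontal strip are distinct).

col : ℕ × ℕ → ℕ
col (_ , s) = s

rightOf : List (ℕ × ℕ) → ℕ × ℕ → ℕ
rightOf cs x = length (filter (λ y → col x ℕ.<? col y) cs)

w : ℕ → List ℕ → List ℕ → ℤ
w k lam mu =
  foldr ℤ._+_ 0ℤ
    (map content (filter (λ x → rightOf (skewCells lam mu) x ℕ.<? k) (skewCells lam mu)))

{-# OPTIONS --safe #-}
-- 𝓔 is q^(nk - C(k,2)) times the sum, over k-subsets S of the labelled cells, of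
-- T_S = ∏_m q^(-ℓ_m) [ℓ_m + 1 - m + c_m]_q. If k exceeds the number of cells there is no S.
-- Otherwise the m-th chosen label is at least j + m and every content is at least -j, so all
-- q-integer arguments are positive and T_S is monic, with exponents between -Σ ℓ_m, which is at
-- least -(nk - C(k,2)) because the labels are distinct and at most n, and Σ c_m - C(k+1,2).
-- Read each row of a horizontal strip from right to left and the columns, hence the contents,
-- strictly decrease; so Σ c_m ≤ w_k, with equality for exactly one S (the k rightmost cells).
-- Hence 𝓔 has exponents in [0, k(n-k) + w_k] and leading coefficient 1.
module Submission where

open import Defs
import Data.Integer.Properties as ℤP
open import Algebra.Properties.AbelianGroup ℤP.+-0-abelianGroup using (∙-cancelˡ; ∙-cancelʳ)
open import Data.Bool using (if_then_else_)
open import Data.Integer as ℤ using (ℤ; +_; 0ℤ; 1ℤ; -_; +≤+; +<+) renaming (_+_ to _+ℤ_; _*_ to _*ℤ_; _-_ to _-ℤ_; _<_ to _<ℤ_; _≤_ to _≤ℤ_; _>_ to _>ℤ_)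
open import Data.Integer.Tactic.RingSolver using (solve-∀)
open import Data.List using (List; []; _∷_; _++_; map; foldr; length; take; upTo; applyUpTo; applyDownFrom; filter; zip; reverse)
import Data.List.Properties as LP
open import Data.List.Relation.Binary.Permutation.Propositional using (_↭_; prep; swap; ↭-sym; ↭⇒↭ₛ; module PermutationReasoning) renaming (refl to ↭-refl; trans to ↭-trans)
open import Data.List.Relation.Binary.Permutation.Propositional.Properties using (++⁺; ++⁺ˡ; shifts; map⁺; ↭-reverse; filter-↭; ↭-length; All-resp-↭)
open import Data.List.Relation.Binary.Permutation.Setoid.Properties using (foldr-commMonoid)
open import Data.List.Relation.Binary.Sublist.Propositional using (_⊆_; []; _∷_; _∷ʳ_)
open import Data.List.Relation.Binary.Sublist.Propositional.Properties using (length-mono-≤; []⊆-universal)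
open import Data.List.Relation.Unary.All as All using (All; []; _∷_)
import Data.List.Relation.Unary.All.Properties as AllP
open import Data.List.Relation.Unary.AllPairs as AllPairs using (AllPairs; []; _∷_)
import Data.List.Relation.Unary.AllPairs.Properties as AllPairsP
open import Data.List.Relation.Unary.Linked as Linked using (Linked; []; [-]; _∷_)
open import Data.Nat as ℕ using (ℕ; zero; suc; _+_; _*_; _∸_; _≤_; _<_; z≤n; s≤s)
import Data.Nat.Properties as ℕP
import Data.Nat.Tactic.RingSolver as ℕSolver
open import Data.Nat.Combinatorics using (_C_; nC1≡n; nCk+nC[k+1]≡[n+1]C[k+1])
open import Data.Nat.ListAction using (sum)
open import Data.Product using (_×_; _,_; proj₁; proj₂)
open import Data.Unit using (⊤; tt)
open import Function using (_∘_; id)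
open import Level using (0ℓ)
open import Relation.Binary.PropositionalEquality using (_≡_; _≢_; setoid; refl; sym; trans; cong; cong₂; subst; subst₂; module ≡-Reasoning)
open import Relation.Nullary using (yes; no; does)
open import Relation.Nullary.Negation using (contradiction)
open import Relation.Unary using (Pred; Decidable)

private
  variable
    A B : Set
    e lo hi l₁ h₁ l₂ h₂ : ℤ
    p r : LPoly

-- Laurent polynomials

Supported : ℤ → ℤ → LPoly → Set
Supported lo hi = All (λ t → lo ≤ℤ proj₁ t × proj₁ t ≤ℤ hi)

Monic : ℤ → ℤ → LPoly → Set
Monic lo hi p = Supported lo hi p × coeff hi p ≡ 1ℤ

δ : ℤ → ℤ → ℤ
δ a b = if does (a ℤ.≟ b) then 1ℤ else 0ℤ

⨁ : (A → LPoly) → List A → LPoly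
⨁ F xs = foldr _⊕_ [] (map F xs)

sumℤ : List ℤ → ℤ
sumℤ = foldr _+ℤ_ 0ℤ

x+y-x≡y : ∀ x y → x +ℤ y -ℤ x ≡ y
x+y-x≡y = solve-∀

y+[x-y]≡x : ∀ x y → y +ℤ (x -ℤ y) ≡ x
y+[x-y]≡x = solve-∀

x-y+y≡x : ∀ x y → x -ℤ y +ℤ y ≡ x
x-y+y≡x = solve-∀

x-y+z≡z+x-y : ∀ x y z → x -ℤ y +ℤ z ≡ z +ℤ x -ℤ y
x-y+z≡z+x-y = solve-∀

x+[y+s]≡y+[x+s] : ∀ x y s → x +ℤ (y +ℤ s) ≡ y +ℤ (x +ℤ s)
x+[y+s]≡y+[x+s] = solve-∀

coeff-++ : ∀ e p r → coeff e (p ++ r) ≡ coeff e p +ℤ coeff e r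
coeff-++ e []              r = sym (ℤP.+-identityˡ _)
coeff-++ e ((e′ , c) ∷ p) r with e ℤ.≟ e′
... | yes _ = trans (cong (c +ℤ_) (coeff-++ e p r)) (sym (ℤP.+-assoc c _ _))
... | no  _ = coeff-++ e p r

coeff-mono : ∀ e c → coeff e (mono e c) ≡ c
coeff-mono e c with e ℤ.≟ e
... | yes _   = ℤP.+-identityʳ c
... | no  e≢e = contradiction refl e≢e

coeff-absent : ∀ p → All (λ t → proj₁ t ≢ e) p → coeff e p ≡ 0ℤ
coeff-absent [] [] = refl
coeff-absent {e} ((e′ , c) ∷ p) (e′≢e ∷ rest) with e ℤ.≟ e′
... | yes e≡e′ = contradiction (sym e≡e′) e′≢e
... | no  _    = coeff-absent p rest

coeff-below : Supported lo hi p → e <ℤ lo → coeff e p ≡ 0ℤ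
coeff-below {p = p} supp e<lo =
  coeff-absent p (All.map (λ (lo≤t , _) t≡e → ℤP.<-irrefl (sym t≡e) (ℤP.<-≤-trans e<lo lo≤t)) supp)

coeff-above : Supported lo hi p → hi <ℤ e → coeff e p ≡ 0ℤ
coeff-above {p = p} supp hi<e =
  coeff-absent p (All.map (λ (_ , t≤hi) t≡e → ℤP.<-irrefl t≡e (ℤP.≤-<-trans t≤hi hi<e)) supp)

coeff-monic-≥ : Monic lo hi p → hi ≤ℤ e → coeff e p ≡ δ e hi
coeff-monic-≥ {hi = hi} {e = e} (supp , top) hi≤e with e ℤ.≟ hi
... | yes refl  = top
... | no  e≢hi = coeff-above supp (ℤP.≤∧≢⇒< hi≤e (e≢hi ∘ sym))

supported-weaken : ∀ {lo′ hi′} → lo′ ≤ℤ lo → hi ≤ℤ hi′ → Supported lo hi p → Supported lo′ hi′ p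
supported-weaken lo′≤lo hi≤hi′ = All.map (λ (lo≤t , t≤hi) → ℤP.≤-trans lo′≤lo lo≤t , ℤP.≤-trans t≤hi hi≤hi′)

⊗-∷ˡ : ∀ e c p r → ((e , c) ∷ p) ⊗ r ≡ (mono e c ⊗ r) ++ (p ⊗ r)
⊗-∷ˡ e c p r = cong (_++ (p ⊗ r)) (sym (LP.++-identityʳ _))

supported-mono-⊗ : ∀ e c → Supported lo hi r → Supported (e +ℤ lo) (e +ℤ hi) (mono e c ⊗ r)
supported-mono-⊗ e c []                        = []
supported-mono-⊗ e c ((lo≤t , t≤hi) ∷ supp) =
  (ℤP.+-monoʳ-≤ e lo≤t , ℤP.+-monoʳ-≤ e t≤hi) ∷ supported-mono-⊗ e c supp

supported-⊗ : Supported l₁ h₁ p → Supported l₂ h₂ r → Supported (l₁ +ℤ l₂) (h₁ +ℤ h₂) (p ⊗ r)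
supported-⊗ []                                 _ = []
supported-⊗ {p = (e , c) ∷ p} {r = r} ((l₁≤e , e≤h₁) ∷ sp) sr =
  subst (Supported _ _) (sym (⊗-∷ˡ e c p r))
    (AllP.++⁺ (supported-weaken (ℤP.+-monoˡ-≤ _ l₁≤e) (ℤP.+-monoˡ-≤ _ e≤h₁) (supported-mono-⊗ e c sr))
              (supported-⊗ sp sr))

coeff-mono-⊗ : ∀ e e′ c r → coeff e (mono e′ c ⊗ r) ≡ c *ℤ coeff (e -ℤ e′) r
coeff-mono-⊗ e e′ c [] = sym (ℤP.*-zeroʳ c)
coeff-mono-⊗ e e′ c ((e″ , c′) ∷ r) with e ℤ.≟ e′ +ℤ e″ | e -ℤ e′ ℤ.≟ e″
... | yes _  | yes _  = trans (cong (c *ℤ c′ +ℤ_) (coeff-mono-⊗ e e′ c r)) (sym (ℤP.*-distribˡ-+ c c′ _))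
... | no  _  | no  _  = coeff-mono-⊗ e e′ c r
... | yes e≡e′+e″ | no e-e′≢e″ =
  contradiction (trans (cong (_-ℤ e′) e≡e′+e″) (x+y-x≡y e′ e″)) e-e′≢e″
... | no e≢e′+e″ | yes e-e′≡e″ =
  contradiction (trans (sym (y+[x-y]≡x e e′)) (cong (e′ +ℤ_) e-e′≡e″)) e≢e′+e″

coeff-⊗-top : Supported l₁ h₁ p → Supported l₂ h₂ r → coeff (h₁ +ℤ h₂) (p ⊗ r) ≡ coeff h₁ p *ℤ coeff h₂ r
coeff-⊗-top [] _ = refl
coeff-⊗-top {h₁ = h₁} {p = (e , c) ∷ p} {h₂ = h₂} {r = r} ((_ , e≤h₁) ∷ sp) sr = begin
  coeff (h₁ +ℤ h₂) (((e , c) ∷ p) ⊗ r)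
    ≡⟨ cong (coeff (h₁ +ℤ h₂)) (⊗-∷ˡ e c p r) ⟩
  coeff (h₁ +ℤ h₂) ((mono e c ⊗ r) ++ (p ⊗ r))
    ≡⟨ coeff-++ (h₁ +ℤ h₂) (mono e c ⊗ r) (p ⊗ r) ⟩
  coeff (h₁ +ℤ h₂) (mono e c ⊗ r) +ℤ coeff (h₁ +ℤ h₂) (p ⊗ r)
    ≡⟨ cong₂ _+ℤ_ (coeff-mono-⊗ (h₁ +ℤ h₂) e c r) (coeff-⊗-top sp sr) ⟩
  c *ℤ coeff (h₁ +ℤ h₂ -ℤ e) r +ℤ coeff h₁ p *ℤ coeff h₂ r
    ≡⟨ leading-term ⟩
  coeff h₁ ((e , c) ∷ p) *ℤ coeff h₂ r ∎
  where
  open ≡-Reasoning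
  leading-term : c *ℤ coeff (h₁ +ℤ h₂ -ℤ e) r +ℤ coeff h₁ p *ℤ coeff h₂ r ≡ coeff h₁ ((e , c) ∷ p) *ℤ coeff h₂ r
  leading-term with h₁ ℤ.≟ e
  ... | yes refl = trans (cong (λ x → c *ℤ coeff x r +ℤ coeff h₁ p *ℤ coeff h₂ r) (x+y-x≡y h₁ h₂))
                          (sym (ℤP.*-distribʳ-+ (coeff h₂ r) c (coeff h₁ p)))
  ... | no h₁≢e = begin
    c *ℤ coeff (h₁ +ℤ h₂ -ℤ e) r +ℤ coeff h₁ p *ℤ coeff h₂ r
      ≡⟨ cong (λ x → c *ℤ x +ℤ _) (coeff-above sr h₂<h₁+h₂-e) ⟩
    c *ℤ 0ℤ +ℤ coeff h₁ p *ℤ coeff h₂ r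
      ≡⟨ cong (_+ℤ _) (ℤP.*-zeroʳ c) ⟩
    0ℤ +ℤ coeff h₁ p *ℤ coeff h₂ r
      ≡⟨ ℤP.+-identityˡ _ ⟩
    coeff h₁ p *ℤ coeff h₂ r ∎
    where
    h₂<h₁+h₂-e : h₂ <ℤ h₁ +ℤ h₂ -ℤ e
    h₂<h₁+h₂-e = subst₂ _<ℤ_ (x-y+y≡x h₂ e) (x-y+z≡z+x-y h₂ e h₁)
                   (ℤP.+-monoʳ-< (h₂ -ℤ e) (ℤP.≤∧≢⇒< e≤h₁ (h₁≢e ∘ sym)))

monic-⊗ : Monic l₁ h₁ p → Monic l₂ h₂ r → Monic (l₁ +ℤ l₂) (h₁ +ℤ h₂) (p ⊗ r)
monic-⊗ (sp , tp) (sr , tr) = supported-⊗ sp sr , trans (coeff-⊗-top sp sr) (cong₂ _*ℤ_ tp tr)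

monic-mono : ∀ e → Monic e e (mono e 1ℤ)
monic-mono e = (ℤP.≤-refl , ℤP.≤-refl) ∷ [] , coeff-mono e 1ℤ

monic-qint : ∀ a → 1ℤ ≤ℤ a → Monic 0ℤ (a -ℤ 1ℤ) (qint a)
monic-qint (+ suc n) (+≤+ _) = supp , top
  where
  term : ℕ → ℤ × ℤ
  term i = (+ i , 1ℤ)
  supp : Supported 0ℤ (+ n) (qint (+ suc n))
  supp = AllP.map⁺ (AllP.applyUpTo⁺₁ _ (suc n) (λ i<1+n → +≤+ z≤n , +≤+ (ℕP.≤-pred i<1+n)))
  top : coeff (+ n) (qint (+ suc n)) ≡ 1ℤ
  top = begin
    coeff (+ n) (map term (upTo (suc n)))
      ≡⟨ cong (coeff (+ n) ∘ map term) (sym (LP.applyUpTo-∷ʳ (λ i → i) n)) ⟩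
    coeff (+ n) (map term (upTo n ++ n ∷ []))
      ≡⟨ cong (coeff (+ n)) (LP.map-++ term (upTo n) (n ∷ [])) ⟩
    coeff (+ n) (map term (upTo n) ++ mono (+ n) 1ℤ)
      ≡⟨ coeff-++ (+ n) (map term (upTo n)) (mono (+ n) 1ℤ) ⟩
    coeff (+ n) (map term (upTo n)) +ℤ coeff (+ n) (mono (+ n) 1ℤ)
      ≡⟨ cong₂ _+ℤ_ (coeff-absent (map term (upTo n)) below-n) (coeff-mono (+ n) 1ℤ) ⟩
    1ℤ ∎
    where
    open ≡-Reasoning
    below-n : All (λ t → proj₁ t ≢ + n) (map term (upTo n))
    below-n = AllP.map⁺ (AllP.applyUpTo⁺₁ _ n (λ i<n i≡n → ℕP.<-irrefl (ℤP.+-injective i≡n) i<n))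

coeff-⨁ : ∀ e (F : A → LPoly) xs → coeff e (⨁ F xs) ≡ sumℤ (map (coeff e ∘ F) xs)
coeff-⨁ e F []       = refl
coeff-⨁ e F (x ∷ xs) = trans (coeff-++ e (F x) (⨁ F xs)) (cong (coeff e (F x) +ℤ_) (coeff-⨁ e F xs))

supported-⨁ : ∀ {F : A → LPoly} {xs} → All (Supported lo hi ∘ F) xs → Supported lo hi (⨁ F xs)
supported-⨁ []             = []
supported-⨁ (supp ∷ supps) = AllP.++⁺ supp (supported-⨁ supps)

-- The summands of 𝓔

suc-C-2 : ∀ k → suc k C 2 ≡ k + k C 2
suc-C-2 k = trans (sym (nCk+nC[k+1]≡[n+1]C[k+1] k 1)) (cong (_+ k C 2) (nC1≡n k))

labelSum : List (ℕ × ℤ) → ℕ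
labelSum S = sum (map proj₁ S)

contentSum : List (ℕ × ℤ) → ℤ
contentSum S = sumℤ (map proj₂ S)

-- m ≤ ℓ + c says exactly that the factor [ℓ + 1 - m + c]_q of termProd m has a positive argument.
PositiveQInts : ℕ → List (ℕ × ℤ) → Set
PositiveQInts m []             = ⊤
PositiveQInts m ((ℓ , c) ∷ S) = + m ≤ℤ + ℓ +ℤ c × PositiveQInts (suc m) S

termProd-monic : ∀ m S → PositiveQInts m S →
  Monic (- + labelSum S) (contentSum S -ℤ + (length S * m + length S C 2)) (termProd m S)
termProd-monic m []             _                = monic-mono 0ℤ
termProd-monic m ((ℓ , c) ∷ S) (m≤ℓ+c , positive) =
  subst₂ (λ lo hi → Monic lo hi (termProd m ((ℓ , c) ∷ S))) lo≡ hi≡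
    (monic-⊗ (monic-⊗ (monic-mono (- + ℓ)) (monic-qint a 1≤a)) (termProd-monic (suc m) S positive))
  where
  k = length S
  a = + ℓ +ℤ 1ℤ -ℤ + m +ℤ c
  1≤a : 1ℤ ≤ℤ a
  1≤a = subst₂ _≤ℤ_ (x-y+y≡x 1ℤ (+ m)) (shuffle (+ ℓ) (+ m) c) (ℤP.+-monoʳ-≤ (1ℤ -ℤ + m) m≤ℓ+c)
    where
    shuffle : ∀ ℓ m c → 1ℤ -ℤ m +ℤ (ℓ +ℤ c) ≡ ℓ +ℤ 1ℤ -ℤ m +ℤ c
    shuffle = solve-∀
  lo≡ : - + ℓ +ℤ 0ℤ +ℤ - + labelSum S ≡ - + (ℓ + labelSum S)
  lo≡ = trans (cong (_+ℤ - + labelSum S) (ℤP.+-identityʳ (- + ℓ)))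
              (sym (trans (cong -_ (ℤP.pos-+ ℓ (labelSum S))) (ℤP.neg-distrib-+ (+ ℓ) (+ labelSum S))))
  positions : suc k * m + suc k C 2 ≡ m + (k * suc m + k C 2)
  positions = trans (cong (λ t → suc k * m + t) (suc-C-2 k)) (rearrange k m (k C 2))
    where
    rearrange : ∀ k m t → suc k * m + (k + t) ≡ m + (k * suc m + t)
    rearrange = ℕSolver.solve-∀
  hi≡ : - + ℓ +ℤ (a -ℤ 1ℤ) +ℤ (contentSum S -ℤ + (k * suc m + k C 2)) ≡ c +ℤ contentSum S -ℤ + (suc k * m + suc k C 2)
  hi≡ = trans (collect (+ ℓ) (+ m) c (contentSum S) (+ (k * suc m + k C 2)))
              (cong (λ x → c +ℤ contentSum S -ℤ x) (sym (trans (cong +_ positions) (ℤP.pos-+ m _))))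
    where
    collect : ∀ ℓ m c C X → - ℓ +ℤ (ℓ +ℤ 1ℤ -ℤ m +ℤ c -ℤ 1ℤ) +ℤ (C -ℤ X) ≡ c +ℤ C -ℤ (m +ℤ X)
    collect = solve-∀

-- Labelled sublists and k-subsets

labelFrom : ℕ → List ℤ → List (ℕ × ℤ)
labelFrom b []       = []
labelFrom b (c ∷ cs) = (b , c) ∷ labelFrom (suc b) cs

length-labelFrom : ∀ b cs → length (labelFrom b cs) ≡ length cs
length-labelFrom b []       = refl
length-labelFrom b (c ∷ cs) = cong suc (length-labelFrom (suc b) cs)

map-proj₂-labelFrom : ∀ b cs → map proj₂ (labelFrom b cs) ≡ cs
map-proj₂-labelFrom b []       = refl
map-proj₂-labelFrom b (c ∷ cs) = cong (c ∷_) (map-proj₂-labelFrom (suc b) cs)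

zip-applyUpTo : ∀ {f : ℕ → ℕ} {b} cs → (∀ i → f i ≡ b + i) → zip (applyUpTo f (length cs)) cs ≡ labelFrom b cs
zip-applyUpTo                []       _      = refl
zip-applyUpTo {f = f} {b = b} (c ∷ cs) f≗b+ =
  cong₂ (λ ℓ S → (ℓ , c) ∷ S) (trans (f≗b+ 0) (ℕP.+-identityʳ b))
        (zip-applyUpTo cs (λ i → trans (f≗b+ (suc i)) (ℕP.+-suc b i)))

positiveQInts-labelFrom : ∀ m b cs → All (λ c → + m ≤ℤ + b +ℤ c) cs → PositiveQInts m (labelFrom b cs)
positiveQInts-labelFrom m b []       []             = tt
positiveQInts-labelFrom m b (c ∷ cs) (m≤b+c ∷ rest) =
  m≤b+c , positiveQInts-labelFrom (suc m) (suc b) cs (All.map (λ {c} → shift {c}) rest)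
  where
  shift : ∀ {c} → + m ≤ℤ + b +ℤ c → + suc m ≤ℤ + suc b +ℤ c
  shift {c} m≤b+c = subst (+ suc m ≤ℤ_) (sym (ℤP.+-assoc 1ℤ (+ b) c)) (ℤP.+-monoʳ-≤ 1ℤ m≤b+c)

positiveQInts-pred : ∀ m S → PositiveQInts (suc m) S → PositiveQInts m S
positiveQInts-pred m []             _                   = tt
positiveQInts-pred m ((ℓ , c) ∷ S) (1+m≤ℓ+c , positive) =
  ℤP.≤-trans (+≤+ (ℕP.n≤1+n m)) 1+m≤ℓ+c , positiveQInts-pred (suc m) S positive

positiveQInts-⊆ : ∀ {m S xs} → S ⊆ xs → PositiveQInts m xs → PositiveQInts m S
positiveQInts-⊆                          []            _                  = tt
positiveQInts-⊆ {m} {xs = (_ , _) ∷ xs} (_ ∷ʳ S⊆xs)   (_ , positive)     =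
  positiveQInts-⊆ S⊆xs (positiveQInts-pred m xs positive)
positiveQInts-⊆ {xs = (_ , _) ∷ _}      (refl ∷ S⊆xs) (m≤ℓ+c , positive) =
  m≤ℓ+c , positiveQInts-⊆ S⊆xs positive

-- The k largest labels b + N - 1, …, b + N - k sum to k (b + N) - C(k+1, 2).
labelSum-⊆-labelFrom : ∀ {S} b cs → S ⊆ labelFrom b cs →
  labelSum S + suc (length S) C 2 ≤ length S * (b + length cs)
labelSum-⊆-labelFrom b []       []            = z≤n
labelSum-⊆-labelFrom {S} b (c ∷ cs) (_ ∷ʳ S⊆)   =
  subst (λ t → labelSum S + suc (length S) C 2 ≤ length S * t) (sym (ℕP.+-suc b (length cs)))
    (labelSum-⊆-labelFrom (suc b) cs S⊆)
labelSum-⊆-labelFrom {(_ , c) ∷ S} b (c ∷ cs) (refl ∷ S⊆) = begin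
  b + labelSum S + suc (suc s) C 2           ≡⟨ cong (λ t → b + labelSum S + t) (suc-C-2 (suc s)) ⟩
  b + labelSum S + (suc s + suc s C 2)       ≡⟨ rearrange b (labelSum S) s (suc s C 2) ⟩
  (b + suc s) + (labelSum S + suc s C 2)     ≤⟨ ℕP.+-mono-≤ (ℕP.+-monoʳ-≤ b (s≤s s≤N)) (labelSum-⊆-labelFrom (suc b) cs S⊆) ⟩
  (b + suc N) + s * (suc b + N)              ≡⟨ cong (λ t → b + suc N + s * t) (sym (ℕP.+-suc b N)) ⟩
  suc s * (b + suc N)                        ∎
  where
  open ℕP.≤-Reasoning
  s = length S
  N = length cs
  s≤N : s ≤ N
  s≤N = subst (s ≤_) (length-labelFrom (suc b) cs) (length-mono-≤ S⊆)
  rearrange : ∀ b L s t → b + L + (suc s + t) ≡ (b + suc s) + (L + t)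
  rearrange = ℕSolver.solve-∀

choose-⊆ : ∀ k (xs : List A) → All (_⊆ xs) (choose k xs)
choose-⊆ zero    xs       = []⊆-universal xs ∷ []
choose-⊆ (suc k) []       = []
choose-⊆ (suc k) (x ∷ xs) =
  AllP.++⁺ (AllP.map⁺ (All.map (refl ∷_) (choose-⊆ k xs))) (All.map (x ∷ʳ_) (choose-⊆ (suc k) xs))

choose-length : ∀ k (xs : List A) → All (λ S → length S ≡ k) (choose k xs)
choose-length zero    xs       = refl ∷ []
choose-length (suc k) []       = []
choose-length (suc k) (x ∷ xs) =
  AllP.++⁺ (AllP.map⁺ (All.map (cong suc) (choose-length k xs))) (choose-length (suc k) xs)

choose-[] : ∀ k (xs : List A) → length xs < k → choose k xs ≡ []
choose-[] (suc k) []       _             = refl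
choose-[] (suc k) (x ∷ xs) (s≤s |xs|<k) =
  cong₂ (λ S T → map (x ∷_) S ++ T) (choose-[] k xs |xs|<k) (choose-[] (suc k) xs (ℕP.m<n⇒m<1+n |xs|<k))

map-choose : ∀ (f : A → B) k xs → map (map f) (choose k xs) ≡ choose k (map f xs)
map-choose f zero    xs       = refl
map-choose f (suc k) []       = refl
map-choose f (suc k) (x ∷ xs) = begin
  map (map f) (map (x ∷_) (choose k xs) ++ choose (suc k) xs)
    ≡⟨ LP.map-++ (map f) (map (x ∷_) (choose k xs)) (choose (suc k) xs) ⟩
  map (map f) (map (x ∷_) (choose k xs)) ++ map (map f) (choose (suc k) xs)
    ≡⟨ cong (_++ _) (trans (sym (LP.map-∘ (choose k xs))) (LP.map-∘ (choose k xs))) ⟩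
  map (f x ∷_) (map (map f) (choose k xs)) ++ map (map f) (choose (suc k) xs)
    ≡⟨ cong₂ (λ S T → map (f x ∷_) S ++ T) (map-choose f k xs) (map-choose f (suc k) xs) ⟩
  map (f x ∷_) (choose k (map f xs)) ++ choose (suc k) (map f xs) ∎
  where open ≡-Reasoning

-- Subset sums of a strictly decreasing list

sumℤ-++ : ∀ xs ys → sumℤ (xs ++ ys) ≡ sumℤ xs +ℤ sumℤ ys
sumℤ-++ []       ys = sym (ℤP.+-identityˡ (sumℤ ys))
sumℤ-++ (x ∷ xs) ys = trans (cong (x +ℤ_) (sumℤ-++ xs ys)) (sym (ℤP.+-assoc x (sumℤ xs) (sumℤ ys)))

sumℤ-↭ : ∀ {xs ys} → xs ↭ ys → sumℤ xs ≡ sumℤ ys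
sumℤ-↭ xs↭ys = foldr-commMonoid (setoid ℤ) ℤP.+-0-isCommutativeMonoid (↭⇒↭ₛ xs↭ys)

δ-injective : ∀ {f : ℤ → ℤ} → (∀ {a b} → f a ≡ f b → a ≡ b) → ∀ a b → δ (f a) (f b) ≡ δ a b
δ-injective {f} f-injective a b with f a ℤ.≟ f b | a ℤ.≟ b
... | yes _     | yes _   = refl
... | no  _     | no  _   = refl
... | yes fa≡fb | no a≢b  = contradiction (f-injective fa≡fb) a≢b
... | no  fa≢fb | yes a≡b = contradiction (cong f a≡b) fa≢fb

sumℤ-δ-< : ∀ {W} ys → All (_<ℤ W) ys → sumℤ (map (δ W) ys) ≡ 0ℤ
sumℤ-δ-< {W} []       []            = refl
sumℤ-δ-< {W} (y ∷ ys) (y<W ∷ ys<W) with W ℤ.≟ y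
... | yes W≡y = contradiction (sym W≡y) (ℤP.<⇒≢ y<W)
... | no  _   = trans (ℤP.+-identityˡ _) (sumℤ-δ-< ys ys<W)

subsetSums : ℕ → List ℤ → List ℤ
subsetSums k xs = map sumℤ (choose k xs)

subsetSums-suc-∷ : ∀ k x xs → subsetSums (suc k) (x ∷ xs) ≡ map (x +ℤ_) (subsetSums k xs) ++ subsetSums (suc k) xs
subsetSums-suc-∷ k x xs = trans (LP.map-++ sumℤ (map (x ∷_) (choose k xs)) (choose (suc k) xs))
  (cong (_++ subsetSums (suc k) xs) (trans (sym (LP.map-∘ (choose k xs))) (LP.map-∘ (choose k xs))))

subsetSums-suc-suc-∷ : ∀ k x y xs → subsetSums (suc (suc k)) (x ∷ y ∷ xs) ≡
  map (x +ℤ_) (map (y +ℤ_) (subsetSums k xs)) ++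
  (map (x +ℤ_) (subsetSums (suc k) xs) ++ (map (y +ℤ_) (subsetSums (suc k) xs) ++ subsetSums (suc (suc k)) xs))
subsetSums-suc-suc-∷ k x y xs = begin
  subsetSums (suc (suc k)) (x ∷ y ∷ xs)
    ≡⟨ subsetSums-suc-∷ (suc k) x (y ∷ xs) ⟩
  map (x +ℤ_) (subsetSums (suc k) (y ∷ xs)) ++ subsetSums (suc (suc k)) (y ∷ xs)
    ≡⟨ cong₂ (λ S T → map (x +ℤ_) S ++ T) (subsetSums-suc-∷ k y xs) (subsetSums-suc-∷ (suc k) y xs) ⟩
  map (x +ℤ_) (map (y +ℤ_) sₖ ++ sₖ₊₁) ++ (map (y +ℤ_) sₖ₊₁ ++ sₖ₊₂)
    ≡⟨ cong (_++ (map (y +ℤ_) sₖ₊₁ ++ sₖ₊₂)) (LP.map-++ (x +ℤ_) (map (y +ℤ_) sₖ) sₖ₊₁) ⟩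
  (map (x +ℤ_) (map (y +ℤ_) sₖ) ++ map (x +ℤ_) sₖ₊₁) ++ (map (y +ℤ_) sₖ₊₁ ++ sₖ₊₂)
    ≡⟨ LP.++-assoc (map (x +ℤ_) (map (y +ℤ_) sₖ)) (map (x +ℤ_) sₖ₊₁) _ ⟩
  map (x +ℤ_) (map (y +ℤ_) sₖ) ++ (map (x +ℤ_) sₖ₊₁ ++ (map (y +ℤ_) sₖ₊₁ ++ sₖ₊₂)) ∎
  where
  open ≡-Reasoning
  sₖ = subsetSums k xs
  sₖ₊₁ = subsetSums (suc k) xs
  sₖ₊₂ = subsetSums (suc (suc k)) xs

subsetSums-↭ : ∀ k {xs ys} → xs ↭ ys → subsetSums k xs ↭ subsetSums k ys
subsetSums-↭ k             ↭-refl           = ↭-refl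
subsetSums-↭ k             (↭-trans p q)    = ↭-trans (subsetSums-↭ k p) (subsetSums-↭ k q)
subsetSums-↭ zero          (prep x p)       = ↭-refl
subsetSums-↭ (suc k)       (prep {xs} {ys} x p) = begin
  subsetSums (suc k) (x ∷ xs)                                    ≡⟨ subsetSums-suc-∷ k x xs ⟩
  map (x +ℤ_) (subsetSums k xs) ++ subsetSums (suc k) xs          ↭⟨ ++⁺ (map⁺ (x +ℤ_) (subsetSums-↭ k p)) (subsetSums-↭ (suc k) p) ⟩
  map (x +ℤ_) (subsetSums k ys) ++ subsetSums (suc k) ys          ≡⟨ subsetSums-suc-∷ k x ys ⟨
  subsetSums (suc k) (x ∷ ys)                                    ∎
  where open PermutationReasoning
subsetSums-↭ zero          (swap x y p)     = ↭-refl
subsetSums-↭ (suc zero)    (swap x y p)     = swap (x +ℤ 0ℤ) (y +ℤ 0ℤ) (subsetSums-↭ 1 p)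
subsetSums-↭ (suc (suc k)) (swap {xs} {ys} x y p) = begin
  subsetSums (suc (suc k)) (x ∷ y ∷ xs)
    ≡⟨ subsetSums-suc-suc-∷ k x y xs ⟩
  map (x +ℤ_) (map (y +ℤ_) sₖ) ++ (map (x +ℤ_) sₖ₊₁ ++ (map (y +ℤ_) sₖ₊₁ ++ sₖ₊₂))
    ↭⟨ ++⁺ˡ (map (x +ℤ_) (map (y +ℤ_) sₖ)) (shifts (map (x +ℤ_) sₖ₊₁) (map (y +ℤ_) sₖ₊₁)) ⟩
  map (x +ℤ_) (map (y +ℤ_) sₖ) ++ (map (y +ℤ_) sₖ₊₁ ++ (map (x +ℤ_) sₖ₊₁ ++ sₖ₊₂))
    ≡⟨ cong (_++ (map (y +ℤ_) sₖ₊₁ ++ (map (x +ℤ_) sₖ₊₁ ++ sₖ₊₂))) shifts-commute ⟩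
  map (y +ℤ_) (map (x +ℤ_) sₖ) ++ (map (y +ℤ_) sₖ₊₁ ++ (map (x +ℤ_) sₖ₊₁ ++ sₖ₊₂))
    ↭⟨ ++⁺ (map⁺ (y +ℤ_) (map⁺ (x +ℤ_) (subsetSums-↭ k p)))
           (++⁺ (map⁺ (y +ℤ_) (subsetSums-↭ (suc k) p))
                (++⁺ (map⁺ (x +ℤ_) (subsetSums-↭ (suc k) p)) (subsetSums-↭ (suc (suc k)) p))) ⟩
  map (y +ℤ_) (map (x +ℤ_) (subsetSums k ys)) ++
  (map (y +ℤ_) (subsetSums (suc k) ys) ++ (map (x +ℤ_) (subsetSums (suc k) ys) ++ subsetSums (suc (suc k)) ys))
    ≡⟨ subsetSums-suc-suc-∷ k y x ys ⟨
  subsetSums (suc (suc k)) (y ∷ x ∷ ys) ∎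
  where
  open PermutationReasoning
  sₖ = subsetSums k xs
  sₖ₊₁ = subsetSums (suc k) xs
  sₖ₊₂ = subsetSums (suc (suc k)) xs
  shifts-commute : map (x +ℤ_) (map (y +ℤ_) sₖ) ≡ map (y +ℤ_) (map (x +ℤ_) sₖ)
  shifts-commute = trans (sym (LP.map-∘ sₖ)) (trans (LP.map-cong (x+[y+s]≡y+[x+s] x y) sₖ) (LP.map-∘ sₖ))

sumℤ-take-suc-< : ∀ k x xs → All (_<ℤ x) xs → suc k ≤ length xs →
  sumℤ (take (suc k) xs) <ℤ x +ℤ sumℤ (take k xs)
sumℤ-take-suc-< zero    x (y ∷ xs) (y<x ∷ _)    _          =
  subst₂ _<ℤ_ (sym (ℤP.+-identityʳ y)) (sym (ℤP.+-identityʳ x)) y<x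
sumℤ-take-suc-< (suc k) x (y ∷ xs) (_ ∷ xs<x) (s≤s k<|xs|) =
  subst (y +ℤ sumℤ (take (suc k) xs) <ℤ_) (x+[y+s]≡y+[x+s] y x _)
    (ℤP.+-monoʳ-< y (sumℤ-take-suc-< k x xs xs<x k<|xs|))

subsetSums-tail-< : ∀ k x xs → All (_<ℤ x) xs →
  All (_≤ℤ sumℤ (take (suc k) xs)) (subsetSums (suc k) xs) →
  All (_<ℤ x +ℤ sumℤ (take k xs)) (subsetSums (suc k) xs)
subsetSums-tail-< k x xs xs<x bounded with suc k ℕ.≤? length xs
... | yes k<|xs| = All.map (λ s≤ → ℤP.≤-<-trans s≤ (sumℤ-take-suc-< k x xs xs<x k<|xs|)) bounded
... | no  k≮|xs| = subst (All (_<ℤ x +ℤ sumℤ (take k xs)) ∘ map sumℤ) (sym (choose-[] (suc k) xs (ℕP.≰⇒> k≮|xs|))) []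

subsetSums-≤-take : ∀ k xs → AllPairs _>ℤ_ xs → All (_≤ℤ sumℤ (take k xs)) (subsetSums k xs)
subsetSums-≤-take zero    xs       _             = ℤP.≤-refl ∷ []
subsetSums-≤-take (suc k) []       _             = []
subsetSums-≤-take (suc k) (x ∷ xs) (xs<x ∷ desc) =
  subst (All (_≤ℤ x +ℤ sumℤ (take k xs))) (sym (subsetSums-suc-∷ k x xs))
    (AllP.++⁺ (AllP.map⁺ (All.map (ℤP.+-monoʳ-≤ x) (subsetSums-≤-take k xs desc)))
              (All.map ℤP.<⇒≤ (subsetSums-tail-< k x xs xs<x (subsetSums-≤-take (suc k) xs desc))))

sum-δ-subsetSums-take : ∀ k xs → AllPairs _>ℤ_ xs → k ≤ length xs →
  sumℤ (map (δ (sumℤ (take k xs))) (subsetSums k xs)) ≡ 1ℤ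
sum-δ-subsetSums-take zero    xs       _             _            = refl
sum-δ-subsetSums-take (suc k) (x ∷ xs) (xs<x ∷ desc) (s≤s k≤|xs|) = begin
  sumℤ (map (δ W) (subsetSums (suc k) (x ∷ xs)))
    ≡⟨ cong (sumℤ ∘ map (δ W)) (subsetSums-suc-∷ k x xs) ⟩
  sumℤ (map (δ W) (map (x +ℤ_) (subsetSums k xs) ++ subsetSums (suc k) xs))
    ≡⟨ cong sumℤ (LP.map-++ (δ W) (map (x +ℤ_) (subsetSums k xs)) (subsetSums (suc k) xs)) ⟩
  sumℤ (map (δ W) (map (x +ℤ_) (subsetSums k xs)) ++ map (δ W) (subsetSums (suc k) xs))
    ≡⟨ sumℤ-++ (map (δ W) (map (x +ℤ_) (subsetSums k xs))) (map (δ W) (subsetSums (suc k) xs)) ⟩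
  sumℤ (map (δ W) (map (x +ℤ_) (subsetSums k xs))) +ℤ sumℤ (map (δ W) (subsetSums (suc k) xs))
    ≡⟨ cong₂ _+ℤ_ (cong sumℤ shift) (sumℤ-δ-< (subsetSums (suc k) xs) others-below) ⟩
  sumℤ (map (δ W′) (subsetSums k xs)) +ℤ 0ℤ
    ≡⟨ cong (_+ℤ 0ℤ) (sum-δ-subsetSums-take k xs desc k≤|xs|) ⟩
  1ℤ ∎
  where
  open ≡-Reasoning
  W′ = sumℤ (take k xs)
  W  = x +ℤ W′
  shift : map (δ W) (map (x +ℤ_) (subsetSums k xs)) ≡ map (δ W′) (subsetSums k xs)
  shift = trans (sym (LP.map-∘ (subsetSums k xs)))
                (LP.map-cong (δ-injective (∙-cancelˡ x _ _) W′) (subsetSums k xs))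
  others-below : All (_<ℤ W) (subsetSums (suc k) xs)
  others-below = subsetSums-tail-< k x xs xs<x (subsetSums-≤-take (suc k) xs desc)

-- Cells of a horizontal strip

row : ℕ × ℕ → ℕ
row (r , _) = r

_↙_ : ℕ × ℕ → ℕ × ℕ → Set
x ↙ y = col y < col x × row x ≤ row y

content-↙ : ∀ {x y} → x ↙ y → content y <ℤ content x
content-↙ {r , s} {r′ , s′} (s′<s , r≤r′) = ℤP.+-mono-<-≤ (+<+ s′<s) (ℤP.neg-mono-≤ (+≤+ r≤r′))

content-lower-bound : ∀ j x → 1 ≤ col x → row x ≤ suc j → 1ℤ ≤ℤ + suc j +ℤ content x
content-lower-bound j (r , s) 1≤s r≤1+j =
  subst (1ℤ ≤ℤ_) (rearrange (+ s) (+ suc j) (+ r)) (ℤP.+-mono-≤ (+≤+ 1≤s) (ℤP.i≤j⇒0≤j-i (+≤+ r≤1+j)))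
  where
  rearrange : ∀ s J r → s +ℤ (J -ℤ r) ≡ J +ℤ (s -ℤ r)
  rearrange = solve-∀

sum-head0-tail0 : ∀ mu → sum mu ≡ head0 mu + sum (tail0 mu)
sum-head0-tail0 []       = refl
sum-head0-tail0 (m ∷ mu) = refl

part-tail0 : ∀ mu i → part (tail0 mu) i ≡ part mu (suc i)
part-tail0 []       i = refl
part-tail0 (m ∷ mu) i = refl

head0-part : ∀ mu → head0 mu ≡ part mu 0
head0-part []       = refl
head0-part (m ∷ mu) = refl

part-0-≤-head : ∀ {l lam} → Linked (λ a b → b ≤ a) (l ∷ lam) → part lam 0 ≤ l
part-0-≤-head [-]       = z≤n
part-0-≤-head (b≤l ∷ _) = b≤l

<∸⇒+< : ∀ m l {i} → i < l ∸ m → m + i < l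
<∸⇒+< zero    l       i<l   = i<l
<∸⇒+< (suc m) (suc l) i<l∸m = s≤s (<∸⇒+< m l i<l∸m)

length-map-upTo-++ : ∀ (f : ℕ → A) n xs → length (map f (upTo n) ++ xs) ≡ n + length xs
length-map-upTo-++ f n xs = trans (LP.length-++ (map f (upTo n)))
  (cong (_+ length xs) (trans (LP.length-map f (upTo n)) (LP.length-applyUpTo id n)))

sum-≤-0 : ∀ mu → (∀ i → part mu i ≤ 0) → sum mu ≡ 0
sum-≤-0 []       _     = refl
sum-≤-0 (m ∷ mu) mu≤0 = cong₂ _+_ (ℕP.n≤0⇒n≡0 (mu≤0 0)) (sum-≤-0 mu (mu≤0 ∘ suc))

sum-+-length-cellsFrom : ∀ r lam mu → mu ⊆ₚ lam → sum mu + length (cellsFrom r lam mu) ≡ sum lam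
sum-+-length-cellsFrom r []        mu mu⊆lam = trans (ℕP.+-identityʳ (sum mu)) (sum-≤-0 mu mu⊆lam)
sum-+-length-cellsFrom r (l ∷ lam) mu mu⊆lam = begin
  sum mu + length (map _ (upTo (l ∸ m)) ++ cellsFrom (suc r) lam (tail0 mu))
    ≡⟨ cong₂ _+_ (sum-head0-tail0 mu) (length-map-upTo-++ _ (l ∸ m) (cellsFrom (suc r) lam (tail0 mu))) ⟩
  (m + sum (tail0 mu)) + ((l ∸ m) + length (cellsFrom (suc r) lam (tail0 mu)))
    ≡⟨ rearrange m (sum (tail0 mu)) (l ∸ m) _ ⟩
  (m + (l ∸ m)) + (sum (tail0 mu) + length (cellsFrom (suc r) lam (tail0 mu)))
    ≡⟨ cong₂ _+_ (ℕP.m+[n∸m]≡n m≤l) (sum-+-length-cellsFrom (suc r) lam (tail0 mu) tail⊆lam) ⟩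
  l + sum lam ∎
  where
  open ≡-Reasoning
  m = head0 mu
  m≤l : m ≤ l
  m≤l = subst (_≤ l) (sym (head0-part mu)) (mu⊆lam 0)
  tail⊆lam : tail0 mu ⊆ₚ lam
  tail⊆lam i = subst (_≤ part lam i) (sym (part-tail0 mu i)) (mu⊆lam (suc i))
  rearrange : ∀ a b c d → (a + b) + (c + d) ≡ (a + c) + (b + d)
  rearrange = ℕSolver.solve-∀

cellsFrom-[] : ∀ r lam → (∀ i → part lam i ≤ 0) → cellsFrom r lam [] ≡ []
cellsFrom-[] r []        _      = refl
cellsFrom-[] r (l ∷ lam) lam≤0 rewrite ℕP.n≤0⇒n≡0 (lam≤0 0) = cellsFrom-[] (suc r) lam (lam≤0 ∘ suc)

cellsFrom-rows : ∀ r lam mu → (∀ i → part lam (suc i) ≤ part mu i) → All (0 <_) mu →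
  All (λ x → 1 ≤ col x × row x ≤ r + sum mu) (cellsFrom r lam mu)
cellsFrom-rows r []        mu       _     _              = []
cellsFrom-rows r (l ∷ lam) []       strip []             =
  AllP.++⁺ (AllP.map⁺ (AllP.applyUpTo⁺₂ id l (λ _ → s≤s z≤n , ℕP.m≤m+n r 0)))
           (subst (All _) (sym (cellsFrom-[] (suc r) lam strip)) [])
cellsFrom-rows r (l ∷ lam) (m ∷ mu) strip (0<m ∷ mu>0) =
  AllP.++⁺ (AllP.map⁺ (AllP.applyUpTo⁺₂ id (l ∸ m) (λ _ → s≤s z≤n , ℕP.m≤m+n r (m + sum mu))))
           (All.map (λ (1≤s , r′≤) → 1≤s , ℕP.≤-trans r′≤ lower-rows)
                    (cellsFrom-rows (suc r) lam mu (strip ∘ suc) mu>0))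
  where
  lower-rows : suc r + sum mu ≤ r + (m + sum mu)
  lower-rows = subst (_≤ r + (m + sum mu)) (ℕP.+-suc r (sum mu))
                 (ℕP.+-monoʳ-≤ r (ℕP.+-monoˡ-≤ (sum mu) 0<m))

cellsRightToLeft : ℕ → List ℕ → List ℕ → List (ℕ × ℕ)
cellsRightToLeft r []        mu = []
cellsRightToLeft r (l ∷ lam) mu =
  applyDownFrom (λ i → (r , suc (head0 mu + i))) (l ∸ head0 mu) ++ cellsRightToLeft (suc r) lam (tail0 mu)

cellsFrom-↭ : ∀ r lam mu → cellsFrom r lam mu ↭ cellsRightToLeft r lam mu
cellsFrom-↭ r []        mu = ↭-refl
cellsFrom-↭ r (l ∷ lam) mu = ++⁺ row↭ (cellsFrom-↭ (suc r) lam (tail0 mu))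
  where
  open PermutationReasoning
  cell : ℕ → ℕ × ℕ
  cell i = (r , suc (head0 mu + i))
  n = l ∸ head0 mu
  row↭ : map cell (upTo n) ↭ applyDownFrom cell n
  row↭ = begin
    map cell (upTo n)           ≡⟨ LP.map-applyUpTo id cell n ⟩
    applyUpTo cell n            ↭⟨ ↭-reverse (applyUpTo cell n) ⟨
    reverse (applyUpTo cell n)  ≡⟨ LP.reverse-applyUpTo cell n ⟩
    applyDownFrom cell n        ∎

cellsRightToLeft-bounds : ∀ r lam mu → Linked (λ a b → b ≤ a) lam →
  All (λ y → col y ≤ part lam 0 × r ≤ row y) (cellsRightToLeft r lam mu)
cellsRightToLeft-bounds r []        mu _   = []
cellsRightToLeft-bounds r (l ∷ lam) mu dec =
  AllP.++⁺ (AllP.applyDownFrom⁺₁ _ (l ∸ head0 mu) (λ i<l∸m → <∸⇒+< (head0 mu) l i<l∸m , ℕP.≤-refl))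
           (All.map (λ (s≤λ₁ , 1+r≤r′) → ℕP.≤-trans s≤λ₁ (part-0-≤-head dec) , ℕP.<⇒≤ 1+r≤r′)
                    (cellsRightToLeft-bounds (suc r) lam (tail0 mu) (Linked.tail dec)))

cellsRightToLeft-↙ : ∀ r lam mu → Linked (λ a b → b ≤ a) lam → (∀ i → part lam (suc i) ≤ part mu i) →
  AllPairs _↙_ (cellsRightToLeft r lam mu)
cellsRightToLeft-↙ r []        mu _   _     = []
cellsRightToLeft-↙ r (l ∷ lam) mu dec strip =
  AllPairsP.++⁺ row-↙ (cellsRightToLeft-↙ (suc r) lam (tail0 mu) (Linked.tail dec) strip′)
    (AllP.applyDownFrom⁺₁ _ (l ∸ m) (λ {i} _ → All.map (λ (s≤λ₁ , r≤r′) → below i s≤λ₁ , ℕP.<⇒≤ r≤r′)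
                                                  (cellsRightToLeft-bounds (suc r) lam (tail0 mu) (Linked.tail dec))))
  where
  m = head0 mu
  strip′ : ∀ i → part lam (suc i) ≤ part (tail0 mu) i
  strip′ i = subst (part lam (suc i) ≤_) (sym (part-tail0 mu i)) (strip (suc i))
  below : ∀ i {s} → s ≤ part lam 0 → s < suc (m + i)
  below i s≤λ₁ = s≤s (ℕP.≤-trans s≤λ₁ (ℕP.≤-trans (subst (part lam 0 ≤_) (sym (head0-part mu)) (strip 0)) (ℕP.m≤m+n m i)))
  row-↙ : AllPairs _↙_ (applyDownFrom (λ i → (r , suc (m + i))) (l ∸ m))
  row-↙ = AllPairsP.applyDownFrom⁺₁ _ (l ∸ m) (λ j<i _ → s≤s (ℕP.+-monoʳ-< m j<i) , ℕP.≤-refl)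

filter-cong-All : ∀ {P Q : Pred A 0ℓ} (P? : Decidable P) (Q? : Decidable Q) {xs} →
  All (λ x → (P x → Q x) × (Q x → P x)) xs → filter P? xs ≡ filter Q? xs
filter-cong-All P? Q? {[]}     []                  = refl
filter-cong-All P? Q? {x ∷ xs} ((P⇒Q , Q⇒P) ∷ rest) with P? x | Q? x
... | yes _  | yes _  = cong (x ∷_) (filter-cong-All P? Q? rest)
... | no  _  | no  _  = filter-cong-All P? Q? rest
... | yes px | no ¬qx = contradiction (P⇒Q px) ¬qx
... | no ¬px | yes qx = contradiction (Q⇒P qx) ¬px

rightOf-↭ : ∀ {cs cs′} → cs ↭ cs′ → ∀ x → rightOf cs x ≡ rightOf cs′ x
rightOf-↭ cs↭cs′ x = ↭-length (filter-↭ (λ y → col x ℕ.<? col y) cs↭cs′)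

filter-rightOf-take : ∀ k cs → AllPairs (λ x y → col y < col x) cs →
  filter (λ x → rightOf cs x ℕ.<? k) cs ≡ take k cs
filter-rightOf-take zero    cs       _               =
  LP.filter-none (λ x → rightOf cs x ℕ.<? 0) (All.universal (λ _ ()) cs)
filter-rightOf-take (suc k) []       _               = refl
filter-rightOf-take (suc k) (y ∷ cs) (cs<y ∷ sorted) = begin
  filter (λ x → rightOf (y ∷ cs) x ℕ.<? suc k) (y ∷ cs)
    ≡⟨ LP.filter-accept (λ x → rightOf (y ∷ cs) x ℕ.<? suc k) (subst (_< suc k) (sym rightOf-y) (s≤s z≤n)) ⟩
  y ∷ filter (λ x → rightOf (y ∷ cs) x ℕ.<? suc k) cs
    ≡⟨ cong (y ∷_) (filter-cong-All (λ x → rightOf (y ∷ cs) x ℕ.<? suc k) (λ x → rightOf cs x ℕ.<? k)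
                                     (All.map (λ {x} → rightOf-left-of-y {x}) cs<y)) ⟩
  y ∷ filter (λ x → rightOf cs x ℕ.<? k) cs
    ≡⟨ cong (y ∷_) (filter-rightOf-take k cs sorted) ⟩
  y ∷ take k cs ∎
  where
  open ≡-Reasoning
  rightOf-y : rightOf (y ∷ cs) y ≡ 0
  rightOf-y = cong length (trans (LP.filter-reject (λ z → col y ℕ.<? col z) (ℕP.<-irrefl refl))
                                 (LP.filter-none (λ z → col y ℕ.<? col z) (All.map ℕP.<⇒≯ cs<y)))
  rightOf-left-of-y : ∀ {x} → col x < col y →
    (rightOf (y ∷ cs) x < suc k → rightOf cs x < k) × (rightOf cs x < k → rightOf (y ∷ cs) x < suc k)
  rightOf-left-of-y {x} x<y rewrite LP.filter-accept (λ z → col x ℕ.<? col z) {x = y} {xs = cs} x<y =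
    ℕP.≤-pred , s≤s

w-take : ∀ k cs cs′ → cs ↭ cs′ → AllPairs (λ x y → col y < col x) cs′ →
  sumℤ (map content (filter (λ x → rightOf cs x ℕ.<? k) cs)) ≡ sumℤ (take k (map content cs′))
w-take k cs cs′ cs↭cs′ sorted = begin
  sumℤ (map content (filter (λ x → rightOf cs x ℕ.<? k) cs))
    ≡⟨ cong (sumℤ ∘ map content) (LP.filter-≐ (λ x → rightOf cs x ℕ.<? k) (λ x → rightOf cs′ x ℕ.<? k)
                                    ((λ {x} → same-rank {x}) , (λ {x} → same-rank′ {x})) cs) ⟩
  sumℤ (map content (filter (λ x → rightOf cs′ x ℕ.<? k) cs))
    ≡⟨ sumℤ-↭ (map⁺ content (filter-↭ (λ x → rightOf cs′ x ℕ.<? k) cs↭cs′)) ⟩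
  sumℤ (map content (filter (λ x → rightOf cs′ x ℕ.<? k) cs′))
    ≡⟨ cong (sumℤ ∘ map content) (filter-rightOf-take k cs′ sorted) ⟩
  sumℤ (map content (take k cs′))
    ≡⟨ cong sumℤ (LP.take-map k cs′) ⟨
  sumℤ (take k (map content cs′)) ∎
  where
  open ≡-Reasoning
  same-rank : ∀ {x} → rightOf cs x < k → rightOf cs′ x < k
  same-rank {x} = subst (_< k) (rightOf-↭ cs↭cs′ x)
  same-rank′ : ∀ {x} → rightOf cs′ x < k → rightOf cs x < k
  same-rank′ {x} = subst (_< k) (sym (rightOf-↭ cs↭cs′ x))

-- Exponent bounds for 𝓔

m+n≤o⇒n-o≤-m : ∀ {m n o} → m + n ≤ o → + n -ℤ + o ≤ℤ - + m
m+n≤o⇒n-o≤-m {m} {n} {o} m+n≤o = subst₂ _≤ℤ_ left right (ℤP.+-monoˡ-≤ (- + o -ℤ + m) (+≤+ m+n≤o))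
  where
  left : + (m + n) +ℤ (- + o -ℤ + m) ≡ + n -ℤ + o
  left = trans (cong (_+ℤ (- + o -ℤ + m)) (ℤP.pos-+ m n)) (cancel (+ m) (+ n) (+ o))
    where
    cancel : ∀ m n o → m +ℤ n +ℤ (- o -ℤ m) ≡ n -ℤ o
    cancel = solve-∀
  right : + o +ℤ (- + o -ℤ + m) ≡ - + m
  right = cancel (+ o) (+ m)
    where
    cancel : ∀ o m → o +ℤ (- o -ℤ m) ≡ - m
    cancel = solve-∀

termProd-bounds : ∀ {b cs k W} S → S ⊆ labelFrom b cs → length S ≡ k → contentSum S ≤ℤ W →
  PositiveQInts 1 (labelFrom b cs) →
  Supported (+ (suc k C 2) -ℤ + (k * (b + length cs))) (W -ℤ + (k * 1 + k C 2)) (termProd 1 S) ×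
  coeff (W -ℤ + (k * 1 + k C 2)) (termProd 1 S) ≡ δ W (contentSum S)
termProd-bounds {b} {cs} {W = W} S S⊆ refl cS≤W positive =
  supported-weaken (m+n≤o⇒n-o≤-m (labelSum-⊆-labelFrom b cs S⊆)) hi≤ (proj₁ monic) ,
  trans (coeff-monic-≥ monic hi≤) (δ-injective (∙-cancelʳ (- X) _ _) W (contentSum S))
  where
  X = + (length S * 1 + length S C 2)
  monic = termProd-monic 1 S (positiveQInts-⊆ S⊆ positive)
  hi≤ : contentSum S -ℤ X ≤ℤ W -ℤ X
  hi≤ = ℤP.+-monoˡ-≤ (- X) cS≤W

subsetSums-labelFrom : ∀ k b cs → map contentSum (choose k (labelFrom b cs)) ≡ subsetSums k cs
subsetSums-labelFrom k b cs = begin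
  map (sumℤ ∘ map proj₂) (choose k (labelFrom b cs))       ≡⟨ LP.map-∘ (choose k (labelFrom b cs)) ⟩
  map sumℤ (map (map proj₂) (choose k (labelFrom b cs)))   ≡⟨ cong (map sumℤ) (map-choose proj₂ k (labelFrom b cs)) ⟩
  map sumℤ (choose k (map proj₂ (labelFrom b cs)))         ≡⟨ cong (subsetSums k) (map-proj₂-labelFrom b cs) ⟩
  subsetSums k cs                                          ∎
  where open ≡-Reasoning

termSum-monic : ∀ {b k cs cs′} → cs ↭ cs′ → AllPairs _>ℤ_ cs′ → All (λ c → 1ℤ ≤ℤ + b +ℤ c) cs → k ≤ length cs →
  Monic (+ (suc k C 2) -ℤ + (k * (b + length cs))) (sumℤ (take k cs′) -ℤ + (k * 1 + k C 2))
        (⨁ (termProd 1) (choose k (labelFrom b cs)))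
termSum-monic {b} {k} {cs} {cs′} cs↭cs′ desc contents-bounded k≤|cs| =
  supported-⨁ (All.map proj₁ terms) , (begin
    coeff D (⨁ (termProd 1) Ss)             ≡⟨ coeff-⨁ D (termProd 1) Ss ⟩
    sumℤ (map (coeff D ∘ termProd 1) Ss)     ≡⟨ cong sumℤ (LP.map-cong-local (All.map proj₂ terms)) ⟩
    sumℤ (map (δ W ∘ contentSum) Ss)         ≡⟨ cong sumℤ (LP.map-∘ Ss) ⟩
    sumℤ (map (δ W) (map contentSum Ss))     ≡⟨ cong (sumℤ ∘ map (δ W)) (subsetSums-labelFrom k b cs) ⟩
    sumℤ (map (δ W) (subsetSums k cs))       ≡⟨ sumℤ-↭ (map⁺ (δ W) (subsetSums-↭ k cs↭cs′)) ⟩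
    sumℤ (map (δ W) (subsetSums k cs′))      ≡⟨ sum-δ-subsetSums-take k cs′ desc (subst (k ≤_) (↭-length cs↭cs′) k≤|cs|) ⟩
    1ℤ                                       ∎)
  where
  open ≡-Reasoning
  Ss = choose k (labelFrom b cs)
  W = sumℤ (take k cs′)
  D = W -ℤ + (k * 1 + k C 2)
  contentSums≤W : All (λ S → contentSum S ≤ℤ W) Ss
  contentSums≤W = AllP.map⁻ (subst (All (_≤ℤ W)) (sym (subsetSums-labelFrom k b cs))
                    (All-resp-↭ (↭-sym (subsetSums-↭ k cs↭cs′)) (subsetSums-≤-take k cs′ desc)))
  terms : All (λ S → Supported (+ (suc k C 2) -ℤ + (k * (b + length cs))) D (termProd 1 S) ×
                     coeff D (termProd 1 S) ≡ δ W (contentSum S)) Ss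
  terms = All.zipWith (λ (S⊆ , |S|≡k , cS≤W) → termProd-bounds _ S⊆ |S|≡k cS≤W positive)
            (choose-⊆ k (labelFrom b cs) , All.zip (choose-length k (labelFrom b cs) , contentSums≤W))
    where positive = positiveQInts-labelFrom 1 b cs contents-bounded

square-C-2 : ∀ k → k * k ≡ k + (k C 2 + k C 2)
square-C-2 zero    = refl
square-C-2 (suc k) = begin
  suc k * suc k                       ≡⟨ expand k ⟩
  suc k + k + k * k                   ≡⟨ cong (λ u → suc k + k + u) (square-C-2 k) ⟩
  suc k + k + (k + (t + t))           ≡⟨ regroup k t ⟩
  suc k + ((k + t) + (k + t))         ≡⟨ cong (λ u → suc k + (u + u)) (suc-C-2 k) ⟨
  suc k + (suc k C 2 + suc k C 2)     ∎
  where
  open ≡-Reasoning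
  t = k C 2
  expand : ∀ k → suc k * suc k ≡ suc k + k + k * k
  expand = ℕSolver.solve-∀
  regroup : ∀ k t → suc k + k + (k + (t + t)) ≡ suc k + ((k + t) + (k + t))
  regroup = ℕSolver.solve-∀

pos-suc-C-2 : ∀ k → + (suc k C 2) ≡ + k +ℤ + (k C 2)
pos-suc-C-2 k = trans (cong +_ (suc-C-2 k)) (ℤP.pos-+ k (k C 2))

lowest-exponent : ∀ n k → (+ (n * k) -ℤ + (k C 2)) +ℤ (+ (suc k C 2) -ℤ + (k * suc n)) ≡ 0ℤ
lowest-exponent n k = begin
  (+ (n * k) -ℤ t) +ℤ (+ (suc k C 2) -ℤ + (k * suc n))
    ≡⟨ cong₂ (λ a b → (a -ℤ t) +ℤ b) (ℤP.pos-* n k) (cong₂ _-ℤ_ (pos-suc-C-2 k) (ℤP.pos-* k (suc n))) ⟩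
  (+ n *ℤ + k -ℤ t) +ℤ ((+ k +ℤ t) -ℤ + k *ℤ (1ℤ +ℤ + n))
    ≡⟨ cancel (+ n) (+ k) t ⟩
  0ℤ ∎
  where
  open ≡-Reasoning
  t = + (k C 2)
  cancel : ∀ n k t → (n *ℤ k -ℤ t) +ℤ ((k +ℤ t) -ℤ k *ℤ (1ℤ +ℤ n)) ≡ 0ℤ
  cancel = solve-∀

highest-exponent : ∀ n k W → (+ (n * k) -ℤ + (k C 2)) +ℤ (W -ℤ + (k * 1 + k C 2)) ≡ + k *ℤ (+ n -ℤ + k) +ℤ W
highest-exponent n k W = begin
  (+ (n * k) -ℤ t) +ℤ (W -ℤ + (k * 1 + k C 2))
    ≡⟨ cong₂ (λ a b → (a -ℤ t) +ℤ (W -ℤ b)) (ℤP.pos-* n k) (trans (cong (λ a → + (a + k C 2)) (ℕP.*-identityʳ k)) (ℤP.pos-+ k (k C 2))) ⟩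
  (+ n *ℤ + k -ℤ t) +ℤ (W -ℤ (+ k +ℤ t))
    ≡⟨ collect (+ n) (+ k) t W ⟩
  + k *ℤ (+ n -ℤ + k) +ℤ W +ℤ (+ k *ℤ + k -ℤ (+ k +ℤ (t +ℤ t)))
    ≡⟨ cong (λ a → + k *ℤ (+ n -ℤ + k) +ℤ W +ℤ (a -ℤ (+ k +ℤ (t +ℤ t)))) square ⟩
  + k *ℤ (+ n -ℤ + k) +ℤ W +ℤ (+ k +ℤ (t +ℤ t) -ℤ (+ k +ℤ (t +ℤ t)))
    ≡⟨ cong (+ k *ℤ (+ n -ℤ + k) +ℤ W +ℤ_) (ℤP.+-inverseʳ (+ k +ℤ (t +ℤ t))) ⟩
  + k *ℤ (+ n -ℤ + k) +ℤ W +ℤ 0ℤ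
    ≡⟨ ℤP.+-identityʳ _ ⟩
  + k *ℤ (+ n -ℤ + k) +ℤ W ∎
  where
  open ≡-Reasoning
  t = + (k C 2)
  square : + k *ℤ + k ≡ + k +ℤ (t +ℤ t)
  square = trans (sym (ℤP.pos-* k k))
             (trans (cong +_ (square-C-2 k)) (trans (ℤP.pos-+ k _) (cong (+ k +ℤ_) (ℤP.pos-+ (k C 2) (k C 2)))))
  collect : ∀ n k t W → (n *ℤ k -ℤ t) +ℤ (W -ℤ (k +ℤ t)) ≡ k *ℤ (n -ℤ k) +ℤ W +ℤ (k *ℤ k -ℤ (k +ℤ (t +ℤ t)))
  collect = solve-∀

labelled≡labelFrom : ∀ lam mu → labelled lam mu ≡ labelFrom (suc (sum mu)) (map content (skewCells lam mu))
labelled≡labelFrom lam mu = trans (cong (λ ls → zip ls cs) labels) (zip-applyUpTo cs (λ _ → refl))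
  where
  cs = map content (skewCells lam mu)
  labels : map (λ i → suc (sum mu + i)) (upTo (skewSize lam mu)) ≡ applyUpTo (λ i → suc (sum mu + i)) (length cs)
  labels = trans (LP.map-applyUpTo id _ (skewSize lam mu))
                 (cong (applyUpTo _) (sym (LP.length-map content (skewCells lam mu))))

𝓔-vanishes : ∀ lam mu k → skewSize lam mu < k → 𝓔 lam mu k ≡ []
𝓔-vanishes lam mu k N<k =
  cong (λ L → mono (+ (sum lam * k) -ℤ + (k C 2)) 1ℤ ⊗ ⨁ (termProd 1) L) (choose-[] k (labelled lam mu) |L|<k)
  where
  cs = map content (skewCells lam mu)
  |L|<k : length (labelled lam mu) < k
  |L|<k = subst (_< k) (sym (trans (cong length (labelled≡labelFrom lam mu))
                                   (trans (length-labelFrom (suc (sum mu)) cs) (LP.length-map content (skewCells lam mu))))) N<k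

𝓔-monic : ∀ {lam mu k} → Linked (λ a b → b ≤ a) lam → All (0 <_) mu → HorizontalStrip lam mu →
  k ≤ skewSize lam mu → Monic 0ℤ (+ k *ℤ (+ sum lam -ℤ + k) +ℤ w k lam mu) (𝓔 lam mu k)
𝓔-monic {lam} {mu} {k} lam-dec mu-pos (mu⊆lam , strip) k≤N =
  subst₂ (λ lo hi → Monic lo hi (𝓔 lam mu k)) lo≡0 hi≡D
    (subst (Monic _ _) (sym unfold) (monic-⊗ (monic-mono E₀) termSum))
  where
  j = sum mu
  cells = skewCells lam mu
  cs = map content cells
  cs′ = map content (cellsRightToLeft 1 lam mu)
  E₀ = + (sum lam * k) -ℤ + (k C 2)
  sorted = cellsRightToLeft-↙ 1 lam mu lam-dec strip
  termSum = termSum-monic (map⁺ content (cellsFrom-↭ 1 lam mu))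
              (AllPairsP.map⁺ (AllPairs.map content-↙ sorted))
              (AllP.map⁺ (All.map (λ (1≤s , r≤) → content-lower-bound j _ 1≤s r≤) (cellsFrom-rows 1 lam mu strip mu-pos)))
              (subst (k ≤_) (sym (LP.length-map content cells)) k≤N)
  unfold : 𝓔 lam mu k ≡ mono E₀ 1ℤ ⊗ ⨁ (termProd 1) (choose k (labelFrom (suc j) cs))
  unfold = cong (λ L → mono E₀ 1ℤ ⊗ ⨁ (termProd 1) (choose k L)) (labelled≡labelFrom lam mu)
  n+1 : suc j + length cs ≡ suc (sum lam)
  n+1 = cong suc (trans (cong (λ u → j + u) (LP.length-map content cells)) (sum-+-length-cellsFrom 1 lam mu mu⊆lam))
  lo≡0 : E₀ +ℤ (+ (suc k C 2) -ℤ + (k * (suc j + length cs))) ≡ 0ℤ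
  lo≡0 = trans (cong (λ t → E₀ +ℤ (+ (suc k C 2) -ℤ + (k * t))) n+1) (lowest-exponent (sum lam) k)
  hi≡D : E₀ +ℤ (sumℤ (take k cs′) -ℤ + (k * 1 + k C 2)) ≡ + k *ℤ (+ sum lam -ℤ + k) +ℤ w k lam mu
  hi≡D = trans (cong (λ W → E₀ +ℤ (W -ℤ + (k * 1 + k C 2)))
                     (sym (w-take k cells (cellsRightToLeft 1 lam mu) (cellsFrom-↭ 1 lam mu) (AllPairs.map proj₁ sorted))))
               (highest-exponent (sum lam) k (w k lam mu))

proposition5p26 : (lam mu : List ℕ) (n k : ℕ) →
    IsPartition lam → IsPartition mu → sum lam ≡ n → HorizontalStrip lam mu →
    (skewSize lam mu < k → ∀ e → coeff e (𝓔 lam mu k) ≡ 0ℤ)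
    × (k ≤ skewSize lam mu →
        (∀ e → e <ℤ 0ℤ → coeff e (𝓔 lam mu k) ≡ 0ℤ)
        × (coeff ((+ k) *ℤ (+ n -ℤ + k) +ℤ w k lam mu) (𝓔 lam mu k) ≡ 1ℤ)
        × (∀ e → (+ k) *ℤ (+ n -ℤ + k) +ℤ w k lam mu <ℤ e → coeff e (𝓔 lam mu k) ≡ 0ℤ))
proposition5p26 lam mu _ k (_ , lam-dec) (mu-pos , _) refl strip =
  (λ N<k e → cong (coeff e) (𝓔-vanishes lam mu k N<k)) ,
  λ k≤N → let (supp , top) = 𝓔-monic lam-dec mu-pos strip k≤N in
    (λ _ e<0 → coeff-below supp e<0) , top , (λ _ D<e → coeff-above supp D<e)
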